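{- Let $(\Gamma,\Delta)$ be a Dynkin biagram whose tropical $T$-system $\mathbf t^\lambda$ is periodic for every initial labeling $\lambda\in\mathbb R^n$, and let $f$ be a bicolored automorphism of its associated $B$-matrix. Then the tropical $T$-system associated to the folded pair $(f(\Gamma),f(\Delta))$ is also periodic for every initial labeling.
   Context: A Cartan matrix of finite type is an integer matrix which after simultaneous permutation is block diagonal with blocks Cartan matrices of connected Dynkin diagrams ($A,B,C,D,E,F,G$); its Coxeter adjacency matrix is $2I-C$. A Dynkin biagram is a pair $(\Gamma,\Delta)$ of $n\times n$ Coxeter adjacency matrices with disjoint supports and a coloring $\epsilon:[n]\to\{\circ,\bullet\}$ with $\Gamma_{ij}=\Delta_{ij}=0$ whenever $\epsilon_i=\epsilon_j$. Its associated $B$-matrix is $B=\tilde\Gamma+\tilde\Delta$, $\tilde\Gamma_{ij}=\Gamma_{ij}$ if $\epsilon_i=\circ,\epsilon_j=\bullet$, $-\Gamma_{ij}$ if $\epsilon_i=\bullet,\epsilon_j=\circ$, $0$ otherwise; $\tilde\Delta_{ij}=\Delta_{ij}$ if $\epsilon_i=\bullet,\epsilon_j=\circ$, $-\Delta_{ij}$ if $\epsilon_i=\circ,\epsilon_j=\bullet$, $0$ otherwise. A bicolored automorphism is a bijection $f:[n]\to[n]$ with (i) $\epsilon_{f(i)}=\epsilon_i$; (ii) $b_{i_1j}b_{i_2j}\ge0$ for $i_1,i_2$ in the same $f$-orbit and all $j$; (iii) $b_{f(i)f(j)}=b_{ij}$; (iv) $b_{ij}=b_{ji}=0$ for $i,j$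 in the same orbit. The folded matrices are indexed by $f$-orbits: $f(\Gamma)_{IJ}=\sum_{i\in I}\Gamma_{ij}$, $f(\Delta)_{IJ}=\sum_{i\in I}\Delta_{ij}$ for any $j\in J$, orbits colored by the color of their elements. For a pair of nonnegative matrices $(\Gamma,\Delta)$ indexed by a colored set, call $(k,t)$ admissible if ($\epsilon_k=\circ$, $t$ even) or ($\epsilon_k=\bullet$, $t$ odd); the tropical $T$-system with initial labeling $\lambda$ is given by $\mathbf t^\lambda_k(0)=\lambda_k$ ($\epsilon_k=\circ$), $\mathbf t^\lambda_k(1)=\lambda_k$ ($\epsilon_k=\bullet$), $\mathbf t^\lambda_k(t+1)+\mathbf t^\lambda_k(t-1)=\max(\sum_i\Gamma_{ik}\mathbf t^\lambda_i(t),\sum_j\Delta_{jk}\mathbf t^\lambda_j(t))$; it is periodic if some $N>0$ has $\mathbf t^\lambda_k(t+2N)=\mathbf t^\lambda_k(t)$ for all admissible $(k,t)$. -}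

module Defs where

open import Level using (Level; _⊔_) renaming (suc to lsuc)
open import Data.Nat as ℕ using (ℕ; zero; suc; _≡ᵇ_; _%_; _∸_)
open import Data.Bool using (Bool; true; false; if_then_else_; _∧_; _∨_)
open import Data.Integer as ℤ using (ℤ; +_; -[1+_]; 0ℤ)
open import Data.Fin using (Fin; toℕ; splitAt; _≟_)
open import Data.Fin.Permutation using (Permutation; Permutation′; _⟨$⟩ʳ_)
open import Data.List using (List; []; _∷_)
open import Data.Sum using (_⊎_; inj₁; inj₂)
open import Data.Product using (Σ; ∃; _×_; _,_)
open import Function using (_∘_; _⇔_)
open import Relation.Nullary using (yes; no)
open import Relation.Binary.PropositionalEquality using (_≡_)
open import Algebra.Bundles using (AbelianGroup)
open import Algebra.Core using (Op₂)
open import Algebra.Definitions using (Congruent₂)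

Mat : ℕ → Set
Mat n = Fin n → Fin n → ℤ

chain : ℕ → ℕ → Bool
chain i j = (suc i ≡ᵇ j) ∨ (suc j ≡ᵇ i)

slEntry : (ℕ → ℕ → Bool) → ℕ → ℕ → ℤ
slEntry adj i j =
  if i ≡ᵇ j then + 2 else (if adj i j then -[1+ 0 ] else 0ℤ)

override : ℕ → ℕ → ℤ → (ℕ → ℕ → ℤ) → ℕ → ℕ → ℤ
override a b v M i j = if (i ≡ᵇ a) ∧ (j ≡ᵇ b) then v else M i j

entryA : ℕ → ℕ → ℤ
entryA = slEntry chain

entryB : ℕ → ℕ → ℕ → ℤ
entryB m = override (m ∸ 2) (m ∸ 1) -[1+ 1 ] entryA

entryC : ℕ → ℕ → ℕ → ℤ
entryC m i j = entryB m j i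

-- tree: path on nodes 0..m-2, plus node m-1 attached to node b
branchAdj : ℕ → ℕ → ℕ → ℕ → Bool
branchAdj m b i j =
  ((i ℕ.<ᵇ (m ∸ 1)) ∧ (j ℕ.<ᵇ (m ∸ 1)) ∧ chain i j)
  ∨ ((i ≡ᵇ (m ∸ 1)) ∧ (j ≡ᵇ b))
  ∨ ((j ≡ᵇ (m ∸ 1)) ∧ (i ≡ᵇ b))

entryD : ℕ → ℕ → ℕ → ℤ
entryD m = slEntry (branchAdj m (m ∸ 3))

entryE : ℕ → ℕ → ℕ → ℤ
entryE m = slEntry (branchAdj m 2)

entryF4 : ℕ → ℕ → ℤ
entryF4 = override 1 2 -[1+ 1 ] entryA

entryG2 : ℕ → ℕ → ℤ
entryG2 = override 1 0 -[1+ 2 ] entryA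

data DynkinType : Set where
  A : ℕ → DynkinType   -- A k  is  A_{k+1}
  B : ℕ → DynkinType   -- B k  is  B_{k+2}
  C : ℕ → DynkinType   -- C k  is  C_{k+2}
  D : ℕ → DynkinType   -- D k  is  D_{k+4}
  E6 E7 E8 F4 G2 : DynkinType

rank : DynkinType → ℕ
rank (A k) = suc k
rank (B k) = 2 ℕ.+ k
rank (C k) = 2 ℕ.+ k
rank (D k) = 4 ℕ.+ k
rank E6 = 6
rank E7 = 7
rank E8 = 8
rank F4 = 4
rank G2 = 2

entry : DynkinType → ℕ → ℕ → ℤ
entry (A k) = entryA
entry (B k) = entryB (2 ℕ.+ k)
entry (C k) = entryC (2 ℕ.+ k)
entry (D k) = entryD (4 ℕ.+ k)
entry E6 = entryE 6
entry E7 = entryE 7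
entry E8 = entryE 8
entry F4 = entryF4
entry G2 = entryG2

cartan : (t : DynkinType) → Mat (rank t)
cartan t i j = entry t (toℕ i) (toℕ j)

totalRank : List DynkinType → ℕ
totalRank [] = 0
totalRank (t ∷ ts) = rank t ℕ.+ totalRank ts

blockDiag : (ts : List DynkinType) → Mat (totalRank ts)
blockDiag [] ()
blockDiag (t ∷ ts) i j with splitAt (rank t) i | splitAt (rank t) j
... | inj₁ a | inj₁ b = cartan t a b
... | inj₂ a | inj₂ b = blockDiag ts a b
... | inj₁ _ | inj₂ _ = 0ℤ
... | inj₂ _ | inj₁ _ = 0ℤ

IsFiniteCartan : (n : ℕ) → Mat n → Set
IsFiniteCartan n M =
  Σ (List DynkinType) λ ts → Σ (Permutation n (totalRank ts)) λ σ →
    ∀ i j → M i j ≡ blockDiag ts (σ ⟨$⟩ʳ i) (σ ⟨$⟩ʳ j)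

δ : {n : ℕ} → Fin n → Fin n → ℤ
δ i j with i ≟ j
... | yes _ = + 1
... | no _ = 0ℤ

IsCoxeterAdj : (n : ℕ) → Mat n → Set
IsCoxeterAdj n Γ = IsFiniteCartan n (λ i j → (+ 2 ℤ.* δ i j) ℤ.- Γ i j)

data Color : Set where
  white black : Color

record DynkinBiagram (n : ℕ) : Set where
  field
    Γ Δ      : Mat n
    ε        : Fin n → Color
    Γ-cox    : IsCoxeterAdj n Γ
    Δ-cox    : IsCoxeterAdj n Δ
    disjoint : ∀ i j → Γ i j ≡ 0ℤ ⊎ Δ i j ≡ 0ℤ
    bipart   : ∀ i j → ε i ≡ ε j → Γ i j ≡ 0ℤ × Δ i j ≡ 0ℤ

Γ~ : {n : ℕ} → (Fin n → Color) → Mat n → Mat n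
Γ~ ε Γ i j with ε i | ε j
... | white | black = Γ i j
... | black | white = ℤ.- Γ i j
... | _ | _ = 0ℤ

Δ~ : {n : ℕ} → (Fin n → Color) → Mat n → Mat n
Δ~ ε Δ i j with ε i | ε j
... | black | white = Δ i j
... | white | black = ℤ.- Δ i j
... | _ | _ = 0ℤ

Bmat : {n : ℕ} → DynkinBiagram n → Mat n
Bmat G i j = Γ~ ε Γ i j ℤ.+ Δ~ ε Δ i j
  where open DynkinBiagram G

iter : {n : ℕ} → Permutation′ n → ℕ → Fin n → Fin n
iter f zero i = i
iter f (suc k) i = f ⟨$⟩ʳ (iter f k i)

SameOrbit : {n : ℕ} → Permutation′ n → Fin n → Fin n → Set
SameOrbit f i j = ∃ λ k → iter f k i ≡ j

record IsBicoloredAutomorphism {n : ℕ} (G : DynkinBiagram n)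
                               (f : Permutation′ n) : Set where
  open DynkinBiagram G
  b = Bmat G
  field
    color-pres : ∀ i → ε (f ⟨$⟩ʳ i) ≡ ε i
    sign-cond  : ∀ i₁ i₂ j → SameOrbit f i₁ i₂ →
                 0ℤ ℤ.≤ (b i₁ j ℤ.* b i₂ j)
    b-invar    : ∀ i j → b (f ⟨$⟩ʳ i) (f ⟨$⟩ʳ j) ≡ b i j
    orbit-zero : ∀ i j → SameOrbit f i j → b i j ≡ 0ℤ × b j i ≡ 0ℤ

-- Folding along an orbit decomposition.
-- The orbits are presented as Fin m via π : Fin n → Fin m (orbit map)
-- and a section sec choosing an element of each orbit.

sumℤ : (m : ℕ) → (Fin m → ℤ) → ℤ
sumℤ zero g = 0ℤ
sumℤ (suc m) g = g Fin.zero ℤ.+ sumℤ m (g ∘ Fin.suc)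
  where import Data.Fin as Fin

fold : {n m : ℕ} → (Fin n → Fin m) → (Fin m → Fin n) → Mat n → Mat m
fold {n} π sec M I J =
  sumℤ n (λ i → if isYes (π i ≟ I) then M i (sec J) else 0ℤ)
  where open import Relation.Nullary.Decidable using (isYes)

-- Totally ordered abelian groups (the value domain of labelings);
-- x ∨ y is the maximum.  ℝ with + and max is an instance.

record OrderedAbelianGroup (a ℓ : Level) : Set (lsuc (a ⊔ ℓ)) where
  field
    abelianGroup : AbelianGroup a ℓ
  open AbelianGroup abelianGroup public
  field
    max        : Op₂ Carrier
    max-cong   : Congruent₂ _≈_ max
    max-comm   : ∀ x y → max x y ≈ max y x
    max-assoc  : ∀ x y z → max (max x y) z ≈ max x (max y z)
    max-idem   : ∀ x → max x x ≈ x
    max-total  : ∀ x y → max x y ≈ x ⊎ max x y ≈ y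
    max-transl : ∀ x y z → (max x y ∙ z) ≈ max (x ∙ z) (y ∙ z)

module _ {a ℓ : Level} (R : OrderedAbelianGroup a ℓ) where
  open OrderedAbelianGroup R

  natMul : ℕ → Carrier → Carrier
  natMul zero x = ε
  natMul (suc k) x = x ∙ natMul k x

  _·_ : ℤ → Carrier → Carrier
  (+ k) · x = natMul k x
  -[1+ k ] · x = natMul (suc k) x ⁻¹

  sumR : (m : ℕ) → (Fin m → Carrier) → Carrier
  sumR zero g = ε
  sumR (suc m) g = g Fin.zero ∙ sumR m (g ∘ Fin.suc)
    where import Data.Fin as Fin

  -- Tropical T-system.  tsys Γ Δ c λ t k is t^λ_k(t); it is
  -- meaningful at admissible (k,t) (values elsewhere are unused, since
  -- the matrices vanish between equally colored indices).
  tsys : {m : ℕ} → Mat m → Mat m → (Fin m → Carrier) → ℕ → Fin m → Carrier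
  tsys Γ Δ λ₀ zero k = λ₀ k
  tsys Γ Δ λ₀ (suc zero) k = λ₀ k
  tsys {m} Γ Δ λ₀ (suc (suc t)) k =
    max (sumR m (λ i → Γ i k · tsys Γ Δ λ₀ (suc t) i))
        (sumR m (λ j → Δ j k · tsys Γ Δ λ₀ (suc t) j))
    ∙ (tsys Γ Δ λ₀ t k) ⁻¹

  Admissible : Color → ℕ → Set
  Admissible white t = t % 2 ≡ 0
  Admissible black t = t % 2 ≡ 1

  Periodic : {m : ℕ} → Mat m → Mat m → (Fin m → Color) →
             (Fin m → Carrier) → Set ℓ
  Periodic {m} Γ Δ c λ₀ =
    Σ ℕ λ N → (0 ℕ.< N) ×
      (∀ k t → Admissible (c k) t →
        tsys Γ Δ λ₀ (t ℕ.+ 2 ℕ.* N) k ≈ tsys Γ Δ λ₀ t k)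

{-# OPTIONS --safe #-}
module Submission where

open import Defs renaming (_·_ to intMul)
open import Level using (Level; _⊔_)
open import Data.Nat as ℕ using (ℕ; zero; suc; _≡ᵇ_)
open import Data.Nat.Properties using (≡ᵇ⇒≡)
open import Data.Bool using (true; false; T; if_then_else_; _∧_)
open import Data.Unit using (tt)
open import Data.Integer as ℤ using (ℤ; +_; -[1+_]; 0ℤ; _≤_; +≤+; -≤+; -_; _-_)
import Data.Integer.Properties as ℤP
open import Algebra.Properties.AbelianGroup ℤP.+-0-abelianGroup using (⁻¹-anti-homo‿-)
open import Data.Fin as Fin using (Fin; splitAt; join; _≟_)
open import Data.Fin.Properties using (toℕ-injective; join-splitAt; punchInᵢ≢i)
open import Data.Fin.Permutation using (Permutation′; _⟨$⟩ʳ_)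
open import Data.List using ([]; _∷_)
open import Data.Sum using (_⊎_; inj₁; inj₂) renaming (swap to ⊎-swap)
open import Data.Product using (_×_; _,_; proj₁; proj₂) renaming (swap to ×-swap)
open import Function using (_∘_; _⇔_; Equivalence; Injection)
open import Function.Properties.Inverse using (↔⇒↣)
open import Relation.Binary.Bundles using (Setoid)
open import Relation.Binary.PropositionalEquality
  using (_≡_; _≢_; refl; sym; trans; cong; cong₂; subst; module ≡-Reasoning)
open import Relation.Nullary using (yes; no; contradiction)
open import Relation.Nullary.Decidable using (isYes)

-- Γ and Δ are nonnegative (finite-type Cartan matrices have nonpositive
-- off-diagonal entries), have disjoint supports and vanish between equally
-- coloured vertices, so the B-matrix determines both of them. Therefore a
-- bicolored automorphism f preserves Γ and Δ, and the column sums
-- Σ_{i ∈ I} Γ_{ij} do not depend on the representative j of the orbit J.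
-- Consequently the T-system of (Γ, Δ) started from μ ∘ π is the pullback of
-- the folded T-system started from μ, and any period of the former is a
-- period of the latter.

NonposOffDiagonal : {A : Set} → (A → A → ℤ) → Set
NonposOffDiagonal M = ∀ {x y} → x ≢ y → M x y ≤ 0ℤ

slEntry-nonposOffDiagonal : ∀ adj → NonposOffDiagonal (slEntry adj)
slEntry-nonposOffDiagonal adj {x} {y} x≢y with x ≡ᵇ y in x≡ᵇy
... | true = contradiction (≡ᵇ⇒≡ x y (subst T (sym x≡ᵇy) tt)) x≢y
... | false with adj x y
...   | true = -≤+
...   | false = ℤP.≤-refl

override-nonposOffDiagonal : ∀ a b {v} M → v ≤ 0ℤ →
  NonposOffDiagonal M → NonposOffDiagonal (override a b v M)
override-nonposOffDiagonal a b M v≤0 M≤0 {x} {y} x≢y with (x ≡ᵇ a) ∧ (y ≡ᵇ b)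
... | true = v≤0
... | false = M≤0 x≢y

entryA-nonposOffDiagonal : NonposOffDiagonal entryA
entryA-nonposOffDiagonal = slEntry-nonposOffDiagonal chain

entryB-nonposOffDiagonal : ∀ m → NonposOffDiagonal (entryB m)
entryB-nonposOffDiagonal m = override-nonposOffDiagonal _ _ entryA -≤+ entryA-nonposOffDiagonal

entry-nonposOffDiagonal : ∀ t → NonposOffDiagonal (entry t)
entry-nonposOffDiagonal (A k) = entryA-nonposOffDiagonal
entry-nonposOffDiagonal (B k) = entryB-nonposOffDiagonal (2 ℕ.+ k)
entry-nonposOffDiagonal (C k) x≢y = entryB-nonposOffDiagonal (2 ℕ.+ k) (x≢y ∘ sym)
entry-nonposOffDiagonal (D k) = slEntry-nonposOffDiagonal (branchAdj (4 ℕ.+ k) (1 ℕ.+ k))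
entry-nonposOffDiagonal E6 = slEntry-nonposOffDiagonal (branchAdj 6 2)
entry-nonposOffDiagonal E7 = slEntry-nonposOffDiagonal (branchAdj 7 2)
entry-nonposOffDiagonal E8 = slEntry-nonposOffDiagonal (branchAdj 8 2)
entry-nonposOffDiagonal F4 = override-nonposOffDiagonal _ _ entryA -≤+ entryA-nonposOffDiagonal
entry-nonposOffDiagonal G2 = override-nonposOffDiagonal _ _ entryA -≤+ entryA-nonposOffDiagonal

splitAt-injective : ∀ k {l} {i j : Fin (k ℕ.+ l)} → splitAt k i ≡ splitAt k j → i ≡ j
splitAt-injective k {l} {i} {j} eq = begin
  i                      ≡⟨ join-splitAt k l i ⟨
  join k l (splitAt k i) ≡⟨ cong (join k l) eq ⟩
  join k l (splitAt k j) ≡⟨ join-splitAt k l j ⟩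
  j                      ∎
  where open ≡-Reasoning

blockDiag-nonposOffDiagonal : ∀ ts → NonposOffDiagonal (blockDiag ts)
blockDiag-nonposOffDiagonal [] {()}
blockDiag-nonposOffDiagonal (t ∷ ts) {i} {j} i≢j
  with splitAt (rank t) i in split-i | splitAt (rank t) j in split-j
... | inj₁ i' | inj₁ j' = entry-nonposOffDiagonal t λ i'≡j' →
  i≢j (splitAt-injective (rank t) (trans split-i (trans (cong inj₁ (toℕ-injective i'≡j')) (sym split-j))))
... | inj₂ i' | inj₂ j' = blockDiag-nonposOffDiagonal ts λ i'≡j' →
  i≢j (splitAt-injective (rank t) (trans split-i (trans (cong inj₂ i'≡j') (sym split-j))))
... | inj₁ _ | inj₂ _ = ℤP.≤-refl
... | inj₂ _ | inj₁ _ = ℤP.≤-refl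

finiteCartan-nonposOffDiagonal : ∀ {n} {M : Mat n} → IsFiniteCartan n M → NonposOffDiagonal M
finiteCartan-nonposOffDiagonal (ts , σ , M≡blockDiag) {i} {j} i≢j =
  subst (_≤ 0ℤ) (sym (M≡blockDiag i j))
    (blockDiag-nonposOffDiagonal ts (i≢j ∘ Injection.injective (↔⇒↣ σ)))

δ-offDiagonal : ∀ {n} {i j : Fin n} → i ≢ j → δ i j ≡ 0ℤ
δ-offDiagonal {i = i} {j} i≢j with i ≟ j
... | yes i≡j = contradiction i≡j i≢j
... | no _ = refl

coxeterAdj-nonneg : ∀ {n} {M : Mat n} → IsCoxeterAdj n M → (∀ i → M i i ≡ 0ℤ) →
  ∀ i j → 0ℤ ≤ M i j
coxeterAdj-nonneg {M = M} cox diag i j with i ≟ j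
... | yes refl = ℤP.≤-reflexive (sym (diag i))
... | no i≢j = ℤP.i-j≤0⇒i≤j
  (subst (λ d → (+ 2 ℤ.* d) - M i j ≤ 0ℤ) (δ-offDiagonal i≢j)
    (finiteCartan-nonposOffDiagonal cox i≢j))

positivePart-disjointDifference : ∀ {a b} → 0ℤ ≤ a → 0ℤ ≤ b →
  a ≡ 0ℤ ⊎ b ≡ 0ℤ → (a - b) ℤ.⊔ 0ℤ ≡ a
positivePart-disjointDifference {a} 0≤a _ (inj₂ refl) =
  trans (cong (ℤ._⊔ 0ℤ) (ℤP.+-identityʳ a)) (ℤP.i≥j⇒i⊔j≡i 0≤a)
positivePart-disjointDifference {b = b} _ 0≤b (inj₁ refl) =
  trans (cong (ℤ._⊔ 0ℤ) (ℤP.+-identityˡ (- b))) (ℤP.i≤j⇒i⊔j≡j (ℤP.neg-mono-≤ 0≤b))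

disjointDifference-injective : ∀ {a b c d} →
  0ℤ ≤ a → 0ℤ ≤ b → 0ℤ ≤ c → 0ℤ ≤ d →
  a ≡ 0ℤ ⊎ b ≡ 0ℤ → c ≡ 0ℤ ⊎ d ≡ 0ℤ → a - b ≡ c - d → a ≡ c × b ≡ d
disjointDifference-injective {a} {b} {c} {d} 0≤a 0≤b 0≤c 0≤d a≡0⊎b≡0 c≡0⊎d≡0 a-b≡c-d =
  (begin
    a                ≡⟨ positivePart-disjointDifference 0≤a 0≤b a≡0⊎b≡0 ⟨
    (a - b) ℤ.⊔ 0ℤ   ≡⟨ cong (ℤ._⊔ 0ℤ) a-b≡c-d ⟩
    (c - d) ℤ.⊔ 0ℤ   ≡⟨ positivePart-disjointDifference 0≤c 0≤d c≡0⊎d≡0 ⟩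
    c                ∎) ,
  (begin
    b                ≡⟨ positivePart-disjointDifference 0≤b 0≤a (⊎-swap a≡0⊎b≡0) ⟨
    (b - a) ℤ.⊔ 0ℤ   ≡⟨ cong (ℤ._⊔ 0ℤ) b-a≡d-c ⟩
    (d - c) ℤ.⊔ 0ℤ   ≡⟨ positivePart-disjointDifference 0≤d 0≤c (⊎-swap c≡0⊎d≡0) ⟩
    d                ∎)
  where
  open ≡-Reasoning
  b-a≡d-c : b - a ≡ d - c
  b-a≡d-c = begin
    b - a         ≡⟨ ⁻¹-anti-homo‿- a b ⟨
    - (a - b)   ≡⟨ cong -_ a-b≡c-d ⟩
    - (c - d)   ≡⟨ ⁻¹-anti-homo‿- c d ⟩
    d - c         ∎

module _ {n} (G : DynkinBiagram n) where
  open DynkinBiagram G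

  Γ-nonneg : ∀ i j → 0ℤ ≤ Γ i j
  Γ-nonneg = coxeterAdj-nonneg Γ-cox (λ i → proj₁ (bipart i i refl))

  Δ-nonneg : ∀ i j → 0ℤ ≤ Δ i j
  Δ-nonneg = coxeterAdj-nonneg Δ-cox (λ i → proj₂ (bipart i i refl))

  Bmat-white-black : ∀ {i j} → ε i ≡ white → ε j ≡ black → Bmat G i j ≡ Γ i j - Δ i j
  Bmat-white-black {i} {j} εi εj rewrite εi | εj = refl

  Bmat-black-white : ∀ {i j} → ε i ≡ black → ε j ≡ white → Bmat G i j ≡ Δ i j - Γ i j
  Bmat-black-white {i} {j} εi εj rewrite εi | εj = ℤP.+-comm (- Γ i j) (Δ i j)

  equalColours-Γ-Δ-agree : ∀ {i j i' j'} → ε i ≡ ε i' → ε j ≡ ε j' → ε i ≡ ε j →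
    Γ i j ≡ Γ i' j' × Δ i j ≡ Δ i' j'
  equalColours-Γ-Δ-agree {i} {j} {i'} {j'} εi≡εi' εj≡εj' εi≡εj =
    let Γij≡0 , Δij≡0 = bipart i j εi≡εj
        Γi'j'≡0 , Δi'j'≡0 = bipart i' j' (trans (sym εi≡εi') (trans εi≡εj εj≡εj'))
    in trans Γij≡0 (sym Γi'j'≡0) , trans Δij≡0 (sym Δi'j'≡0)

  Bmat-determines-Γ-Δ : ∀ {i j i' j'} → ε i ≡ ε i' → ε j ≡ ε j' →
    Bmat G i j ≡ Bmat G i' j' → Γ i j ≡ Γ i' j' × Δ i j ≡ Δ i' j'
  Bmat-determines-Γ-Δ {i} {j} {i'} {j'} εi≡εi' εj≡εj' b≡b' = byColours (ε i) (ε j) refl refl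
    where
    byColours : ∀ cᵢ cⱼ → ε i ≡ cᵢ → ε j ≡ cⱼ → Γ i j ≡ Γ i' j' × Δ i j ≡ Δ i' j'
    byColours white white εi εj = equalColours-Γ-Δ-agree εi≡εi' εj≡εj' (trans εi (sym εj))
    byColours black black εi εj = equalColours-Γ-Δ-agree εi≡εi' εj≡εj' (trans εi (sym εj))
    byColours white black εi εj =
      disjointDifference-injective (Γ-nonneg i j) (Δ-nonneg i j) (Γ-nonneg i' j') (Δ-nonneg i' j')
        (disjoint i j) (disjoint i' j')
        (trans (sym (Bmat-white-black εi εj))
          (trans b≡b' (Bmat-white-black (trans (sym εi≡εi') εi) (trans (sym εj≡εj') εj))))
    byColours black white εi εj = ×-swap
      (disjointDifference-injective (Δ-nonneg i j) (Γ-nonneg i j) (Δ-nonneg i' j') (Γ-nonneg i' j')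
        (⊎-swap (disjoint i j)) (⊎-swap (disjoint i' j'))
        (trans (sym (Bmat-black-white εi εj))
          (trans b≡b' (Bmat-black-white (trans (sym εi≡εi') εi) (trans (sym εj≡εj') εj)))))

module _ {n} {G : DynkinBiagram n} {f : Permutation′ n} (aut : IsBicoloredAutomorphism G f) where
  open DynkinBiagram G
  open IsBicoloredAutomorphism aut

  Γ-invariant : ∀ i j → Γ (f ⟨$⟩ʳ i) (f ⟨$⟩ʳ j) ≡ Γ i j
  Γ-invariant i j = proj₁ (Bmat-determines-Γ-Δ G (color-pres i) (color-pres j) (b-invar i j))

  Δ-invariant : ∀ i j → Δ (f ⟨$⟩ʳ i) (f ⟨$⟩ʳ j) ≡ Δ i j
  Δ-invariant i j = proj₂ (Bmat-determines-Γ-Δ G (color-pres i) (color-pres j) (b-invar i j))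

module _ {c ℓ} (S : Setoid c ℓ) {n} {f : Permutation′ n} {g : Fin n → Setoid.Carrier S} where
  open Setoid S using (_≈_) renaming (refl to ≈-refl; trans to ≈-trans)

  iter-invariant : (∀ k → g (f ⟨$⟩ʳ k) ≈ g k) → ∀ p k → g (iter f p k) ≈ g k
  iter-invariant g∘f≈g zero k = ≈-refl
  iter-invariant g∘f≈g (suc p) k = ≈-trans (g∘f≈g _) (iter-invariant g∘f≈g p k)

  sameOrbit-invariant : (∀ k → g (f ⟨$⟩ʳ k) ≈ g k) → ∀ {i j} → SameOrbit f i j → g j ≈ g i
  sameOrbit-invariant g∘f≈g (p , refl) = iter-invariant g∘f≈g p _

sumℤ-nonneg : ∀ n {c : Fin n → ℤ} → (∀ i → 0ℤ ≤ c i) → 0ℤ ≤ sumℤ n c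
sumℤ-nonneg zero c≥0 = ℤP.≤-refl
sumℤ-nonneg (suc n) c≥0 = ℤP.+-mono-≤ (c≥0 _) (sumℤ-nonneg n (c≥0 ∘ Fin.suc))

if-nonneg : ∀ b {c} → 0ℤ ≤ c → 0ℤ ≤ (if b then c else 0ℤ)
if-nonneg true c≥0 = c≥0
if-nonneg false _ = ℤP.≤-refl

module _ {a ℓ} (R : OrderedAbelianGroup a ℓ) where
  open OrderedAbelianGroup R hiding (refl; sym; trans)
  open OrderedAbelianGroup R using () renaming (refl to ≈-refl; trans to ≈-trans)
  open import Algebra.Properties.CommutativeMonoid.Sum commutativeMonoid
    using (sum; sum-cong-≋; sum-remove; sum-replicate-zero; ∑-comm; ∑-permute)
  import Algebra.Properties.Monoid.Mult monoid as Mult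
  open import Relation.Binary.Reasoning.Setoid setoid

  infixr 8 _·_
  _·_ : ℤ → Carrier → Carrier
  _·_ = intMul R

  natMul≡× : ∀ k x → natMul R k x ≡ k Mult.× x
  natMul≡× zero x = refl
  natMul≡× (suc k) x = cong (x ∙_) (natMul≡× k x)

  natMul-congʳ : ∀ k {x y} → x ≈ y → natMul R k x ≈ natMul R k y
  natMul-congʳ k {x} {y} x≈y rewrite natMul≡× k x | natMul≡× k y = Mult.×-congʳ k x≈y

  ·-congʳ : ∀ c {x y} → x ≈ y → c · x ≈ c · y
  ·-congʳ (+ k) x≈y = natMul-congʳ k x≈y
  ·-congʳ -[1+ k ] x≈y = ⁻¹-cong (natMul-congʳ (suc k) x≈y)

  ·-homo-+ : ∀ {c d} → 0ℤ ≤ c → 0ℤ ≤ d → ∀ x → (c ℤ.+ d) · x ≈ c · x ∙ d · x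
  ·-homo-+ {+ k} {+ l} (+≤+ _) (+≤+ _) x
    rewrite natMul≡× (k ℕ.+ l) x | natMul≡× k x | natMul≡× l x = Mult.×-homo-+ x k l

  sumR≡sum : ∀ m g → sumR R m g ≡ sum g
  sumR≡sum zero g = refl
  sumR≡sum (suc m) g = cong (g Fin.zero ∙_) (sumR≡sum m (g ∘ Fin.suc))

  ·-distribʳ-sumℤ : ∀ n {c : Fin n → ℤ} → (∀ i → 0ℤ ≤ c i) → ∀ x → sumℤ n c · x ≈ sum (λ i → c i · x)
  ·-distribʳ-sumℤ zero c≥0 x = ≈-refl
  ·-distribʳ-sumℤ (suc n) c≥0 x =
    ≈-trans (·-homo-+ (c≥0 _) (sumℤ-nonneg n (c≥0 ∘ Fin.suc)) x)
            (∙-congˡ (·-distribʳ-sumℤ n (c≥0 ∘ Fin.suc) x))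

  sum-single : ∀ {m} (a : Fin m) (g : Fin m → Carrier) → (∀ I → I ≢ a → g I ≈ ε) → sum g ≈ g a
  sum-single {suc m} a g g≈ε = begin
    sum g                           ≈⟨ sum-remove {i = a} g ⟩
    g a ∙ sum (g ∘ Fin.punchIn a)   ≈⟨ ∙-congˡ (sum-cong-≋ (λ I → g≈ε _ (punchInᵢ≢i a I))) ⟩
    g a ∙ sum {m} (λ _ → ε)         ≈⟨ ∙-congˡ (sum-replicate-zero m) ⟩
    g a ∙ ε                         ≈⟨ identityʳ (g a) ⟩
    g a                             ∎

  infixl 7 _ᵀ·_
  _ᵀ·_ : ∀ {n} → Mat n → (Fin n → Carrier) → Fin n → Carrier
  (M ᵀ· x) k = sum (λ i → M i k · x i)

  ᵀ·-invariant : ∀ {n} {f : Permutation′ n} {M : Mat n} {x : Fin n → Carrier} →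
    (∀ i j → M (f ⟨$⟩ʳ i) (f ⟨$⟩ʳ j) ≡ M i j) → (∀ i → x (f ⟨$⟩ʳ i) ≡ x i) →
    ∀ k → (M ᵀ· x) (f ⟨$⟩ʳ k) ≈ (M ᵀ· x) k
  ᵀ·-invariant {f = f} {M} {x} M∘f≡M x∘f≡x k = begin
    sum (λ i → M i (f ⟨$⟩ʳ k) · x i)                       ≈⟨ ∑-permute _ f ⟩
    sum (λ i → M (f ⟨$⟩ʳ i) (f ⟨$⟩ʳ k) · x (f ⟨$⟩ʳ i))   ≈⟨ sum-cong-≋ (λ i → reflexive (cong₂ _·_ (M∘f≡M i k) (x∘f≡x i))) ⟩
    sum (λ i → M i k · x i)                                 ∎

  Intertwines : ∀ {n m} → (Fin n → Fin m) → Mat n → Mat m → Set (a ⊔ ℓ)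
  Intertwines π M M' = ∀ y k → (M ᵀ· (y ∘ π)) k ≈ (M' ᵀ· y) (π k)

  indicator-·-off : ∀ {m} {a I : Fin m} c x → I ≢ a → (if isYes (a ≟ I) then c else 0ℤ) · x ≈ ε
  indicator-·-off {a = a} {I} c x I≢a with a ≟ I
  ... | yes a≡I = contradiction (sym a≡I) I≢a
  ... | no _ = ≈-refl

  indicator-·-on : ∀ {m} (a : Fin m) c x → (if isYes (a ≟ a) then c else 0ℤ) · x ≈ c · x
  indicator-·-on a c x with a ≟ a
  ... | yes _ = ≈-refl
  ... | no a≢a = contradiction refl a≢a

  fold-intertwines : ∀ {n m} (π : Fin n → Fin m) (sec : Fin m → Fin n) {M : Mat n} →
    (∀ i j → 0ℤ ≤ M i j) → (∀ y k → (M ᵀ· (y ∘ π)) (sec (π k)) ≈ (M ᵀ· (y ∘ π)) k) →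
    Intertwines π M (fold π sec M)
  fold-intertwines {n} {m} π sec {M} M≥0 fibreConstant y k = begin
    (M ᵀ· (y ∘ π)) k                          ≈⟨ fibreConstant y k ⟨
    sum (λ i → M i s · y (π i))               ≈⟨ sum-cong-≋ (λ i → indicator-·-on (π i) _ _) ⟨
    sum (λ i → χ i (π i) · y (π i))           ≈⟨ sum-cong-≋ (λ i → sum-single (π i) _ (λ _ → indicator-·-off _ _)) ⟨
    sum (λ i → sum (λ I → χ i I · y I))       ≈⟨ ∑-comm (λ i I → χ i I · y I) ⟩
    sum (λ I → sum (λ i → χ i I · y I))       ≈⟨ sum-cong-≋ (λ I → ·-distribʳ-sumℤ n (λ i → if-nonneg _ (M≥0 i s)) (y I)) ⟨
    sum (λ I → sumℤ n (λ i → χ i I) · y I)    ≡⟨⟩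
    (fold π sec M ᵀ· y) (π k)                 ∎
    where
    s = sec (π k)
    χ : Fin n → Fin m → ℤ
    χ i I = if isYes (π i ≟ I) then M i s else 0ℤ

  orbitFold-intertwines : ∀ {n m} {f : Permutation′ n} (π : Fin n → Fin m) (sec : Fin m → Fin n) →
    (∀ J → π (sec J) ≡ J) → (∀ i j → (π i ≡ π j) ⇔ SameOrbit f i j) →
    ∀ {M : Mat n} → (∀ i j → 0ℤ ≤ M i j) → (∀ i j → M (f ⟨$⟩ʳ i) (f ⟨$⟩ʳ j) ≡ M i j) →
    Intertwines π M (fold π sec M)
  orbitFold-intertwines {f = f} π sec π∘sec≡id π≡⇔sameOrbit {M} M≥0 M∘f≡M =
    fold-intertwines π sec M≥0 λ y k →
      sameOrbit-invariant setoid {g = M ᵀ· (y ∘ π)}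
        (ᵀ·-invariant {f = f} M∘f≡M (λ i → cong y (π∘f≡π i))) (sec-sameOrbit k)
    where
    π∘f≡π : ∀ i → π (f ⟨$⟩ʳ i) ≡ π i
    π∘f≡π i = sym (Equivalence.from (π≡⇔sameOrbit i (f ⟨$⟩ʳ i)) (1 , refl))
    sec-sameOrbit : ∀ k → SameOrbit f k (sec (π k))
    sec-sameOrbit k = Equivalence.to (π≡⇔sameOrbit k (sec (π k))) (sym (π∘sec≡id (π k)))

  intertwines-sumR : ∀ {n m} {π : Fin n → Fin m} (M : Mat n) (M' : Mat m) → Intertwines π M M' →
    ∀ {x} y → (∀ i → x i ≈ y (π i)) →
    ∀ k → sumR R n (λ i → M i k · x i) ≈ sumR R m (λ I → M' I (π k) · y I)
  intertwines-sumR {n} {m} {π} M M' MM' {x} y x≈y∘π k = begin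
    sumR R n (λ i → M i k · x i)        ≡⟨ sumR≡sum n _ ⟩
    (M ᵀ· x) k                          ≈⟨ sum-cong-≋ (λ i → ·-congʳ (M i k) (x≈y∘π i)) ⟩
    (M ᵀ· (y ∘ π)) k                    ≈⟨ MM' y k ⟩
    (M' ᵀ· y) (π k)                     ≡⟨ sumR≡sum m _ ⟨
    sumR R m (λ I → M' I (π k) · y I)   ∎

  module _ {n m} {π : Fin n → Fin m} {Γ Δ : Mat n} {Γ' Δ' : Mat m}
           (ΓΓ' : Intertwines π Γ Γ') (ΔΔ' : Intertwines π Δ Δ') (μ : Fin m → Carrier) where

    tsys-pullback : ∀ t k → tsys R Γ Δ (μ ∘ π) t k ≈ tsys R Γ' Δ' μ t (π k)
    tsys-pullback zero k = ≈-refl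
    tsys-pullback (suc zero) k = ≈-refl
    tsys-pullback (suc (suc t)) k =
      ∙-cong (max-cong (intertwines-sumR Γ Γ' ΓΓ' y (tsys-pullback (suc t)) k)
                       (intertwines-sumR Δ Δ' ΔΔ' y (tsys-pullback (suc t)) k))
             (⁻¹-cong (tsys-pullback t k))
      where y = tsys R Γ' Δ' μ (suc t)

  periodic-descends : ∀ {n m} {π : Fin n → Fin m} {sec : Fin m → Fin n}
    {Γ Δ : Mat n} {Γ' Δ' : Mat m} {c : Fin n → Color} {μ : Fin m → Carrier} →
    (∀ J → π (sec J) ≡ J) →
    (∀ t k → tsys R Γ Δ (μ ∘ π) t k ≈ tsys R Γ' Δ' μ t (π k)) →
    Periodic R Γ Δ c (μ ∘ π) → Periodic R Γ' Δ' (c ∘ sec) μ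
  periodic-descends {π = π} {sec} {Γ} {Δ} {Γ'} {Δ'} {μ = μ} π∘sec≡id pullback (N , N>0 , periodic) =
    N , N>0 , λ K t admissible → begin
      tsys R Γ' Δ' μ (t ℕ.+ 2 ℕ.* N) K             ≈⟨ onSection (t ℕ.+ 2 ℕ.* N) K ⟨
      tsys R Γ Δ (μ ∘ π) (t ℕ.+ 2 ℕ.* N) (sec K)   ≈⟨ periodic (sec K) t admissible ⟩
      tsys R Γ Δ (μ ∘ π) t (sec K)                 ≈⟨ onSection t K ⟩
      tsys R Γ' Δ' μ t K                           ∎
    where
    onSection : ∀ t K → tsys R Γ Δ (μ ∘ π) t (sec K) ≈ tsys R Γ' Δ' μ t K
    onSection t K = ≈-trans (pullback t (sec K)) (reflexive (cong (tsys R Γ' Δ' μ t) (π∘sec≡id K)))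

proposition4p11 : {a ℓ : Level} (R : OrderedAbelianGroup a ℓ) (n : ℕ)
    (G : DynkinBiagram n) (f : Permutation′ n) →
    IsBicoloredAutomorphism G f →
    (∀ (λ₀ : Fin n → OrderedAbelianGroup.Carrier R) →
       Periodic R (DynkinBiagram.Γ G) (DynkinBiagram.Δ G) (DynkinBiagram.ε G) λ₀) →
    (m : ℕ) (π : Fin n → Fin m) (sec : Fin m → Fin n) →
    (∀ J → π (sec J) ≡ J) →
    (∀ i j → (π i ≡ π j) ⇔ SameOrbit f i j) →
    ∀ (μ : Fin m → OrderedAbelianGroup.Carrier R) →
      Periodic R (fold π sec (DynkinBiagram.Γ G)) (fold π sec (DynkinBiagram.Δ G))
        (DynkinBiagram.ε G ∘ sec) μ
proposition4p11 R n G f aut periodic m π sec π∘sec≡id π≡⇔sameOrbit μ =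
  periodic-descends R π∘sec≡id
    (tsys-pullback R (orbitFold (Γ-nonneg G) (Γ-invariant aut))
                     (orbitFold (Δ-nonneg G) (Δ-invariant aut)) μ)
    (periodic (μ ∘ π))
  where orbitFold = orbitFold-intertwines R π sec π∘sec≡id π≡⇔sameOrbit
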